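{- Let $G=(V,E)$ be a finite simple graph with no isolated vertices, let $\Delta$ be its maximum degree, and let $m\ge 1$ be an integer. Define $f:2^V\to\mathbb{R}$ by $f(A)=\sum_{v\in V} m_A(v)$, where $m_A(v)=m$ if [$v\notin A$ and $|N_A(v)|\ge m$] or [$v\in A$ and $|N_A(v)|>0$]; $m_A(v)=m-1$ if $v\in A$ and $|N_A(v)|=0$; and $m_A(v)=|N_A(v)|$ otherwise. Run the greedy algorithm on $U=V$ with potential $f$: start with $S=\emptyset$; while some $u\in V\setminus S$ has $f(S\cup\{u\})-f(S)>0$, add to $S$ a vertex $x\in V\setminus S$ maximizing $f(S\cup\{x\})-f(S)$ (ties broken arbitrarily); then return $S$. Then the returned set $S$ is a fault-tolerant total dominating set of $G$ and $|S|\le \big(1+\ln(\Delta+m-1)\big)\cdot|S^*|$, where $S^*$ is a fault-tolerant total dominating set of $G$ of minimum cardinality.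
   Context: $N(v)$ denotes the set of neighbors of $v$ and $N_A(v)=N(v)\cap A$. A set $S\subseteq V$ is a fault-tolerant total dominating set (with parameter $m$) if every vertex of $V\setminus S$ has at least $m$ neighbors in $S$ and every vertex of $S$ has at least one neighbor in $S$. -}

module Defs where

open import Data.Bool using (Bool; true; false; if_then_else_)
open import Data.Nat using (ℕ; zero; suc; _≤_; _<_; _∸_; _⊔_; _≤ᵇ_; _+_)
open import Data.Fin using (Fin)
open import Data.Fin.Subset using (Subset; _∈_; _∉_; _∩_; _∪_; ⁅_⁆; ∣_∣) renaming (⊥ to ∅)
open import Data.Vec using (tabulate; lookup)
open import Data.List using (foldr; map; allFin)
open import Data.Integer using (ℤ; +_; _-_) renaming (_≤_ to _≤ℤ_; _<_ to _<ℤ_)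
open import Data.Rational.Unnormalised using (ℚᵘ; mkℚᵘ; 1ℚᵘ) renaming (_+_ to _+ᵘ_; _*_ to _*ᵘ_; _≤_ to _≤ᵘ_)
open import Data.Product using (_×_; ∃; Σ-syntax)
open import Relation.Binary.PropositionalEquality using (_≡_)

record Graph (n : ℕ) : Set where
  field
    adj   : Fin n → Fin n → Bool
    sym   : ∀ u v → adj u v ≡ adj v u
    irrefl : ∀ v → adj v v ≡ false
open Graph public

module _ {n : ℕ} (G : Graph n) where

  N : Fin n → Subset n
  N v = tabulate (adj G v)

  degIn : Subset n → Fin n → ℕ
  degIn A v = ∣ N v ∩ A ∣

  deg : Fin n → ℕ
  deg v = ∣ N v ∣

  maxDeg : ℕ
  maxDeg = foldr _⊔_ 0 (map deg (allFin n))

  NoIsolated : Set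
  NoIsolated = ∀ v → ∃ λ u → adj G v u ≡ true

  FTTD : ℕ → Subset n → Set
  FTTD m S = (∀ v → v ∉ S → m ≤ degIn S v) × (∀ v → v ∈ S → 1 ≤ degIn S v)

  MinFTTD : ℕ → Subset n → Set
  MinFTTD m S = FTTD m S × (∀ T → FTTD m T → ∣ S ∣ ≤ ∣ T ∣)

  mA : ℕ → Subset n → Fin n → ℕ
  mA m A v with lookup A v
  ... | false = if m ≤ᵇ degIn A v then m else degIn A v
  ... | true  = if 1 ≤ᵇ degIn A v then m else m ∸ 1

  f : ℕ → Subset n → ℕ
  f m A = foldr _+_ 0 (map (mA m A) (allFin n))

  gain : ℕ → Subset n → Fin n → ℤ
  gain m A u = + f m (A ∪ ⁅ u ⁆) - + f m A

  -- Greedy S T : the greedy algorithm, started from current set S, can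
  -- terminate returning T (ties broken arbitrarily).
  data Greedy (m : ℕ) : Subset n → Subset n → Set where
    stop : ∀ {S} → (∀ u → u ∉ S → gain m S u ≤ℤ + 0) → Greedy m S S
    step : ∀ {S T} (x : Fin n) →
           (∃ λ u → u ∉ S × + 0 <ℤ gain m S u) →
           x ∉ S →
           (∀ u → u ∉ S → gain m S u ≤ℤ gain m S x) →
           Greedy m (S ∪ ⁅ x ⁆) T → Greedy m S T

expTerm : ℚᵘ → ℕ → ℚᵘ
expTerm x zero = 1ℚᵘ
expTerm x (suc i) = (expTerm x i *ᵘ x) *ᵘ mkℚᵘ (+ 1) i   -- mkℚᵘ (+ 1) i = 1/(i+1)

expPartial : ℚᵘ → ℕ → ℚᵘ
expPartial x zero = 1ℚᵘ
expPartial x (suc N) = expPartial x N +ᵘ expTerm x (suc N)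

-- LnBound a b k  encodes the real inequality  a ≤ (1 + ln k) · b  (for k ≥ 1):
-- for b > 0 it is  exp((a - b)/b) ≤ k  (with (a-b) truncated at 0, harmless
-- since exp 0 = 1 ≤ k), i.e. every partial sum of the exponential series of
-- (a ∸ b)/b is ≤ k; for b = 0 it says a ≤ 0.
LnBound : ℕ → ℕ → ℕ → Set
LnBound a zero k = a ≤ 0
LnBound a (suc b) k = ∀ N → expPartial (mkℚᵘ (+ (a ∸ suc b)) b) N ≤ᵘ mkℚᵘ (+ k) 0

module Submission where

-- With m = suc m₀, the potential f is monotone and submodular, and it takes its
-- maximum n·m exactly on supersets of fault-tolerant total dominating sets.  The greedy run stops
-- only when no vertex has positive gain, and then every vertex is saturated: a vertex with no
-- neighbour in S would gain from adding any of its neighbours, and a vertex outside S with fewer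
-- than m neighbours in S would gain from adding itself.  For the size bound we follow Wolsey's
-- analysis of greedy submodular cover: if every gain is at most g + 1, then adding the |S*|
-- vertices of an optimum covers the deficit r = n·m − f(A), so r ≤ |S*|(g + 1).  Hence the
-- quantity |A| + r/(g + 1) + |S*|(1/2 + ⋯ + 1/(g + 1)) never increases along the run, and since
-- the first gain is at most Δ + m − 1 = K we get |S| ≤ |S*|·H_K.  Finally H_K − 1 ≤ ln K, i.e.
-- e^(H_K − 1) ≤ K, follows on partial sums of the exponential series from e^(x+y)(1 − y) ≤ e^x.

open import Data.Bool using (Bool; true; false; T; if_then_else_; _∧_; _∨_; b≤b; f≤t) renaming (_≤_ to _≤ᴮ_)
open import Data.Bool.Properties using (∨-identityʳ) renaming (≤-minimum to ≤ᴮ-minimum; ≤-reflexive to ≤ᴮ-reflexive)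
open import Data.Empty using (⊥; ⊥-elim)
open import Data.Fin using (Fin; zero; suc; _≟_)
open import Data.Fin.Subset using (Subset; inside; outside; _∈_; _∉_; _⊆_; _∩_; _∪_; ⁅_⁆; ∣_∣; ⊤) renaming (⊥ to ∅)
open import Data.Fin.Subset.Properties
  using (_∈?_; ⊆-antisym; p⊆p∪q; q⊆p∪q; x∈p∪q⁺; x∈p∪q⁻; x∈p∩q⁺; x∈p∩q⁻; x∈⁅x⁆; x∈⁅y⁆⇒x≡y; drop-not-there;
         ∪-identityʳ; ∪-assoc; ∩-identityˡ; ∩-zeroʳ; ∉⊥; p⊆q⇒∣p∣≤∣q∣; ∣p∩q∣≤∣q∣; ∣⁅x⁆∣≡1; ∣⊥∣≡0)
import Data.Integer as ℤ
import Data.Integer.Properties as ℤ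
open import Data.List using (List; []; _∷_; length; map; foldr)
import Data.List as List
open import Data.List.Properties using (length-map)
open import Data.Nat hiding (_≟_)
open import Data.Nat.Properties hiding (_≟_)
open import Algebra.Properties.Semiring.Sum +-*-semiring using (sum; ∑-distrib-+; sum-cong-≗; *-distribʳ-sum)
open import Data.Product using (_×_; _,_; ∃)
open import Data.Rational.Unnormalised as ℚ using (ℚᵘ; mkℚᵘ; 0ℚᵘ; 1ℚᵘ; *≡*; *≤*; nonNegative)
  renaming (_+_ to _+ᵘ_; _*_ to _*ᵘ_; _≤_ to _≤ᵘ_; _≃_ to _≃ᵘ_)
import Data.Rational.Unnormalised.Properties as ℚ
open import Data.Rational.Unnormalised.Solver using (module +-*-Solver)
open import Data.Sum using (inj₁; inj₂)
open import Data.Unit using (tt)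
open import Data.Vec using (_∷_; []; lookup; here; tabulate)
open import Data.Vec.Properties using (lookup∘tabulate; lookup-zipWith; lookup-replicate; []=⇒lookup; lookup⇒[]=)
open import Defs renaming (sym to adj-sym)
open import Function using (_∘_; id)
open import Relation.Binary.PropositionalEquality
open import Relation.Nullary using (contradiction; yes; no)

open +-*-Solver using (solve; con; _:+_; _:*_; _:-_; _:=_)

toℕ : Bool → ℕ
toℕ false = 0
toℕ true  = 1

foldr-+-map-tabulate : ∀ {A : Set} {n} (h : A → ℕ) (g : Fin n → A) →
                       foldr _+_ 0 (map h (List.tabulate g)) ≡ sum (h ∘ g)
foldr-+-map-tabulate {n = zero}  h g = refl
foldr-+-map-tabulate {n = suc n} h g = cong (h (g zero) +_) (foldr-+-map-tabulate h (g ∘ suc))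

≤-foldr-⊔-map-tabulate : ∀ {A : Set} {n} (h : A → ℕ) (g : Fin n → A) i →
                         h (g i) ≤ foldr _⊔_ 0 (map h (List.tabulate g))
≤-foldr-⊔-map-tabulate h g zero    = m≤m⊔n _ _
≤-foldr-⊔-map-tabulate h g (suc i) = ≤-trans (≤-foldr-⊔-map-tabulate h (g ∘ suc) i) (m≤n⊔m _ _)

sum-mono-≤ : ∀ {n} {h k : Fin n → ℕ} → (∀ i → h i ≤ k i) → sum h ≤ sum k
sum-mono-≤ {zero}  h≤k = z≤n
sum-mono-≤ {suc n} h≤k = +-mono-≤ (h≤k zero) (sum-mono-≤ (h≤k ∘ suc))

sum-mono-< : ∀ {n} {h k : Fin n → ℕ} → (∀ i → h i ≤ k i) → ∀ i → h i < k i → sum h < sum k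
sum-mono-< h≤k zero    h<k = +-mono-<-≤ h<k (sum-mono-≤ (h≤k ∘ suc))
sum-mono-< h≤k (suc i) h<k = +-mono-≤-< (h≤k zero) (sum-mono-< (h≤k ∘ suc) i h<k)

sum-+-mono-≤ : ∀ {n} {a b c d : Fin n → ℕ} → (∀ i → a i + b i ≤ c i + d i) → sum a + sum b ≤ sum c + sum d
sum-+-mono-≤ {a = a} {b} {c} {d} ab≤cd = begin
  sum a + sum b          ≡⟨ ∑-distrib-+ a b ⟨
  sum (λ i → a i + b i)  ≤⟨ sum-mono-≤ ab≤cd ⟩
  sum (λ i → c i + d i)  ≡⟨ ∑-distrib-+ c d ⟩
  sum c + sum d          ∎
  where open ≤-Reasoning

sum-const : ∀ n c → sum {n} (λ _ → c) ≡ n * c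
sum-const zero    c = refl
sum-const (suc n) c = cong (c +_) (sum-const n c)

∣p∣≡sum : ∀ {n} (p : Subset n) → ∣ p ∣ ≡ sum (toℕ ∘ lookup p)
∣p∣≡sum []            = refl
∣p∣≡sum (inside  ∷ p) = cong suc (∣p∣≡sum p)
∣p∣≡sum (outside ∷ p) = ∣p∣≡sum p

module _ {n : ℕ} where

  ∉⇒lookup≡false : ∀ {x} {p : Subset n} → x ∉ p → lookup p x ≡ false
  ∉⇒lookup≡false {x} {p} x∉p with lookup p x in eq
  ... | true  = contradiction (lookup⇒[]= x p eq) x∉p
  ... | false = refl

  lookup≡false⇒∉ : ∀ {x} {p : Subset n} → lookup p x ≡ false → x ∉ p
  lookup≡false⇒∉ eq x∈p with trans (sym ([]=⇒lookup x∈p)) eq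
  ... | ()

  ⊆⇒lookup-≤ : ∀ {p q : Subset n} → p ⊆ q → ∀ x → lookup p x ≤ᴮ lookup q x
  ⊆⇒lookup-≤ {p} {q} p⊆q x with lookup p x in eq
  ... | false = ≤ᴮ-minimum _
  ... | true  = ≤ᴮ-reflexive (sym ([]=⇒lookup (p⊆q (lookup⇒[]= x p eq))))

  lookup-∪⁅x⁆-x : ∀ (p : Subset n) x → lookup (p ∪ ⁅ x ⁆) x ≡ true
  lookup-∪⁅x⁆-x p x = []=⇒lookup {xs = p ∪ ⁅ x ⁆} (x∈p∪q⁺ (inj₂ (x∈⁅x⁆ x)))

  lookup-∪⁅x⁆-≢ : ∀ (p : Subset n) {x y} → y ≢ x → lookup (p ∪ ⁅ x ⁆) y ≡ lookup p y
  lookup-∪⁅x⁆-≢ p {x} {y} y≢x = begin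
    lookup (p ∪ ⁅ x ⁆) y         ≡⟨ lookup-zipWith _∨_ y p ⁅ x ⁆ ⟩
    lookup p y ∨ lookup ⁅ x ⁆ y  ≡⟨ cong (lookup p y ∨_) (∉⇒lookup≡false (y≢x ∘ x∈⁅y⁆⇒x≡y x)) ⟩
    lookup p y ∨ false           ≡⟨ ∨-identityʳ _ ⟩
    lookup p y                   ∎
    where open ≡-Reasoning

  x∈p⇒p∪⁅x⁆≡p : ∀ {p : Subset n} {x} → x ∈ p → p ∪ ⁅ x ⁆ ≡ p
  x∈p⇒p∪⁅x⁆≡p {p} {x} x∈p = ⊆-antisym p∪⁅x⁆⊆p (p⊆p∪q ⁅ x ⁆)
    where
    p∪⁅x⁆⊆p : p ∪ ⁅ x ⁆ ⊆ p
    p∪⁅x⁆⊆p y∈ with x∈p∪q⁻ p ⁅ x ⁆ y∈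
    ... | inj₁ y∈p     = y∈p
    ... | inj₂ y∈⁅x⁆   rewrite x∈⁅y⁆⇒x≡y x y∈⁅x⁆ = x∈p

  x∈p⇒1≤∣p∣ : ∀ {p : Subset n} {x} → x ∈ p → 1 ≤ ∣ p ∣
  x∈p⇒1≤∣p∣ {p} {x} x∈p = subst (_≤ ∣ p ∣) (∣⁅x⁆∣≡1 x) (p⊆q⇒∣p∣≤∣q∣ ⁅x⁆⊆p)
    where
    ⁅x⁆⊆p : ⁅ x ⁆ ⊆ p
    ⁅x⁆⊆p y∈⁅x⁆ rewrite x∈⁅y⁆⇒x≡y x y∈⁅x⁆ = x∈p

∣p∩[q∪⁅x⁆]∣≡ : ∀ {n} (p q : Subset n) {x} → x ∉ q → ∣ p ∩ (q ∪ ⁅ x ⁆) ∣ ≡ toℕ (lookup p x) + ∣ p ∩ q ∣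
∣p∩[q∪⁅x⁆]∣≡ (s ∷ p) (inside  ∷ q) {zero}  x∉q = contradiction here x∉q
∣p∩[q∪⁅x⁆]∣≡ (s ∷ p) (outside ∷ q) {zero}  x∉q rewrite ∪-identityʳ q with s
... | inside  = refl
... | outside = refl
∣p∩[q∪⁅x⁆]∣≡ (s ∷ p) (t ∷ q) {suc x} x∉q rewrite ∨-identityʳ t with s ∧ t
... | inside  = trans (cong suc (∣p∩[q∪⁅x⁆]∣≡ p q (drop-not-there x∉q))) (sym (+-suc _ _))
... | outside = ∣p∩[q∪⁅x⁆]∣≡ p q (drop-not-there x∉q)

∣p∪⁅x⁆∣≡1+∣p∣ : ∀ {n} (p : Subset n) {x} → x ∉ p → ∣ p ∪ ⁅ x ⁆ ∣ ≡ suc ∣ p ∣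
∣p∪⁅x⁆∣≡1+∣p∣ p {x} x∉p = begin
  ∣ p ∪ ⁅ x ⁆ ∣                 ≡⟨ cong ∣_∣ (∩-identityˡ (p ∪ ⁅ x ⁆)) ⟨
  ∣ ⊤ ∩ (p ∪ ⁅ x ⁆) ∣           ≡⟨ ∣p∩[q∪⁅x⁆]∣≡ ⊤ p x∉p ⟩
  toℕ (lookup ⊤ x) + ∣ ⊤ ∩ p ∣  ≡⟨ cong₂ _+_ (cong toℕ (lookup-replicate x inside)) (cong ∣_∣ (∩-identityˡ p)) ⟩
  suc ∣ p ∣                     ∎
  where open ≡-Reasoning

fromList : ∀ {n} → List (Fin n) → Subset n
fromList []      = ∅
fromList (y ∷ Y) = fromList Y ∪ ⁅ y ⁆

elements : ∀ {n} → Subset n → List (Fin n)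
elements []            = []
elements (inside  ∷ p) = zero ∷ map suc (elements p)
elements (outside ∷ p) = map suc (elements p)

fromList-map-suc : ∀ {n} (Y : List (Fin n)) → fromList (map suc Y) ≡ outside ∷ fromList Y
fromList-map-suc []      = refl
fromList-map-suc (y ∷ Y) = cong (_∪ ⁅ suc y ⁆) (fromList-map-suc Y)

fromList-elements : ∀ {n} (p : Subset n) → fromList (elements p) ≡ p
fromList-elements []            = refl
fromList-elements (inside  ∷ p) rewrite fromList-map-suc (elements p) | fromList-elements p =
  cong (inside ∷_) (∪-identityʳ p)
fromList-elements (outside ∷ p) rewrite fromList-map-suc (elements p) | fromList-elements p = refl

length-elements : ∀ {n} (p : Subset n) → length (elements p) ≡ ∣ p ∣
length-elements []            = refl
length-elements (inside  ∷ p) = cong suc (trans (length-map suc (elements p)) (length-elements p))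
length-elements (outside ∷ p) = trans (length-map suc (elements p)) (length-elements p)

-- The contribution of a single vertex

module _ (m₀ : ℕ) where

  -- m_A(v) for m = suc m₀, as a function of (v ∈ A) and |N_A(v)|
  coverage : Bool → ℕ → ℕ
  coverage false d       = suc m₀ ⊓ d
  coverage true  zero    = m₀
  coverage true  (suc d) = suc m₀

  coverage-≤ : ∀ a d → coverage a d ≤ suc m₀
  coverage-≤ false d       = m⊓n≤m (suc m₀) d
  coverage-≤ true  zero    = n≤1+n m₀
  coverage-≤ true  (suc d) = ≤-refl

  coverage-mono : ∀ {a a′ d d′} → a ≤ᴮ a′ → d ≤ d′ → coverage a d ≤ coverage a′ d′
  coverage-mono {false} b≤b d≤d′                   = ⊓-monoʳ-≤ (suc m₀) d≤d′
  coverage-mono {true}  {d = zero}  {zero}  b≤b _  = ≤-refl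
  coverage-mono {true}  {d = zero}  {suc _} b≤b _  = n≤1+n m₀
  coverage-mono {true}  {d = suc _} {suc _} b≤b _  = ≤-refl
  coverage-mono {d = zero} {zero}  f≤t _           = z≤n
  coverage-mono {d = d}    {suc _} f≤t _           = m⊓n≤m (suc m₀) d

  ⊓-submodular : ∀ {d d′} → d ≤ d′ → suc m₀ ⊓ d + suc m₀ ⊓ suc d′ ≤ suc m₀ ⊓ suc d + suc m₀ ⊓ d′
  ⊓-submodular {d} {d′} d≤d′ with suc d′ ≤? suc m₀
  ... | yes 1+d′≤m = ≤-reflexive (begin
    suc m₀ ⊓ d + suc m₀ ⊓ suc d′
      ≡⟨ cong₂ _+_ (m≥n⇒m⊓n≡n (≤-trans (m≤n⇒m≤1+n d≤d′) 1+d′≤m)) (m≥n⇒m⊓n≡n 1+d′≤m) ⟩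
    d + suc d′
      ≡⟨ +-suc d d′ ⟩
    suc d + d′
      ≡⟨ cong₂ _+_ (m≥n⇒m⊓n≡n (≤-trans (s≤s d≤d′) 1+d′≤m)) (m≥n⇒m⊓n≡n (≤-trans (n≤1+n d′) 1+d′≤m)) ⟨
    suc m₀ ⊓ suc d + suc m₀ ⊓ d′
      ∎)
    where open ≡-Reasoning
  ... | no  1+d′≰m = begin
    suc m₀ ⊓ d + suc m₀ ⊓ suc d′
      ≡⟨ cong (suc m₀ ⊓ d +_) (trans (m≤n⇒m⊓n≡m (m≤n⇒m≤1+n m≤d′)) (sym (m≤n⇒m⊓n≡m m≤d′))) ⟩
    suc m₀ ⊓ d + suc m₀ ⊓ d′
      ≤⟨ +-monoˡ-≤ (suc m₀ ⊓ d′) (⊓-monoʳ-≤ (suc m₀) (n≤1+n d)) ⟩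
    suc m₀ ⊓ suc d + suc m₀ ⊓ d′
      ∎
    where
    open ≤-Reasoning
    m≤d′ = ≤-pred (≰⇒> 1+d′≰m)

  -- the vertex added is not v itself; e says whether it is a neighbour of v
  coverage-submodular : ∀ {a a′ d d′} → a ≤ᴮ a′ → d ≤ d′ → ∀ e →
    coverage a d + coverage a′ (toℕ e + d′) ≤ coverage a (toℕ e + d) + coverage a′ d′
  coverage-submodular _ _ false = ≤-refl
  coverage-submodular {false} b≤b d≤d′ true = ⊓-submodular d≤d′
  coverage-submodular {a} {true} {d} {suc d′} _ _ true = +-monoˡ-≤ (suc m₀) (coverage-mono {a} b≤b (n≤1+n d))
  coverage-submodular {true}  {true} {zero} {zero} b≤b _ true = ≤-reflexive (+-comm m₀ (suc m₀))
  coverage-submodular {false} {true} {zero} {zero} f≤t _ true =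
    ≤-reflexive (cong suc (sym (cong (_+ m₀) (⊓-zeroʳ m₀))))

  -- the vertex added is v itself
  coverage-submodular-self : ∀ {d d′} → d ≤ d′ →
    coverage false d + coverage true d′ ≤ coverage true d + coverage false d′
  coverage-submodular-self {zero}  {zero}   _ = ≤-reflexive (sym (+-identityʳ m₀))
  coverage-submodular-self {zero}  {suc d′} _ = begin
    suc m₀              ≤⟨ m≤m+n (suc m₀) (m₀ ⊓ d′) ⟩
    suc m₀ + m₀ ⊓ d′    ≡⟨ +-suc m₀ (m₀ ⊓ d′) ⟨
    m₀ + suc (m₀ ⊓ d′)  ∎
    where open ≤-Reasoning
  coverage-submodular-self {suc d} {suc d′} 1+d≤1+d′ =
    ≤-trans (≤-reflexive (+-comm _ (suc m₀))) (+-monoʳ-≤ (suc m₀) (⊓-monoʳ-≤ (suc m₀) 1+d≤1+d′))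

  coverage-0<1 : ∀ a → coverage a 0 < coverage a 1
  coverage-0<1 false = s≤s z≤n
  coverage-0<1 true  = ≤-refl

  coverage-false<true : ∀ d → suc d < suc m₀ → coverage false (suc d) < coverage true (suc d)
  coverage-false<true d 1+d<m = subst (_< suc m₀) (sym (m≥n⇒m⊓n≡n (<⇒≤ 1+d<m))) 1+d<m

  coverage-saturated : ∀ a {d} → 1 ≤ d → (a ≡ false → suc m₀ ≤ d) → coverage a d ≡ suc m₀
  coverage-saturated false _         m≤d = m≤n⇒m⊓n≡m (m≤d refl)
  coverage-saturated true  {suc d} _ _   = refl

-- The potential f on a graph

[+a]-[+c]≤[+b]-[+c]⇒a≤b : ∀ a b c → ℤ.+ a ℤ.- ℤ.+ c ℤ.≤ ℤ.+ b ℤ.- ℤ.+ c → a ≤ b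
[+a]-[+c]≤[+b]-[+c]⇒a≤b a b c le = ≮⇒≥ λ b<a → ℤ.<⇒≱ (ℤ.+-monoˡ-< (ℤ.- ℤ.+ c) (ℤ.+<+ b<a)) le

[+a]-[+b]≤0⇒a≤b : ∀ a b → ℤ.+ a ℤ.- ℤ.+ b ℤ.≤ ℤ.+ 0 → a ≤ b
[+a]-[+b]≤0⇒a≤b a b le = ℤ.drop‿+≤+ (ℤ.i-j≤0⇒i≤j le)

0<[+a]-[+b]⇒b<a : ∀ a b → ℤ.+ 0 ℤ.< ℤ.+ a ℤ.- ℤ.+ b → b < a
0<[+a]-[+b]⇒b<a a b lt = ≰⇒> λ a≤b → ℤ.<⇒≱ lt (ℤ.i≤j⇒i-j≤0 (ℤ.+≤+ a≤b))

if-≤ᵇ≡⊓ : ∀ m d → (if m ≤ᵇ d then m else d) ≡ m ⊓ d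
if-≤ᵇ≡⊓ m d with m ≤ᵇ d in eq
... | true  = sym (m≤n⇒m⊓n≡m (≤ᵇ⇒≤ m d (subst T (sym eq) tt)))
... | false = sym (m≥n⇒m⊓n≡n (<⇒≤ (≰⇒> λ m≤d → subst T eq (≤⇒≤ᵇ m≤d))))

module _ {n : ℕ} (G : Graph n) where

  Greedy-stuck : ∀ {m A S} → Greedy G m A S → ∀ u → u ∉ S → gain G m S u ℤ.≤ ℤ.+ 0
  Greedy-stuck (stop stuck)          = stuck
  Greedy-stuck (step _ _ _ _ greedy) = Greedy-stuck greedy

  adj⇒≢ : ∀ {v w} → adj G v w ≡ true → v ≢ w
  adj⇒≢ {v} vw refl with trans (sym (irrefl G v)) vw
  ... | ()

  adj⇒∈N : ∀ {v w} → adj G v w ≡ true → w ∈ N G v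
  adj⇒∈N {v} {w} vw = lookup⇒[]= w (N G v) (trans (lookup∘tabulate (adj G v) w) vw)

  deg≤maxDeg : ∀ v → deg G v ≤ maxDeg G
  deg≤maxDeg = ≤-foldr-⊔-map-tabulate (deg G) id

  1≤maxDeg : 1 ≤ n → NoIsolated G → 1 ≤ maxDeg G
  1≤maxDeg (s≤s z≤n) noIsolated with noIsolated zero
  ... | w , 0w = ≤-trans (x∈p⇒1≤∣p∣ (adj⇒∈N 0w)) (deg≤maxDeg zero)

  degIn-∅ : ∀ v → degIn G ∅ v ≡ 0
  degIn-∅ v = trans (cong ∣_∣ (∩-zeroʳ (N G v))) (∣⊥∣≡0 n)

  degIn-∪⁅⁆ : ∀ {A u} → u ∉ A → ∀ v → degIn G (A ∪ ⁅ u ⁆) v ≡ toℕ (adj G v u) + degIn G A v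
  degIn-∪⁅⁆ {A} {u} u∉A v =
    trans (∣p∩[q∪⁅x⁆]∣≡ (N G v) A u∉A) (cong (λ b → toℕ b + degIn G A v) (lookup∘tabulate (adj G v) u))

  degIn-mono : ∀ {A B} → A ⊆ B → ∀ v → degIn G A v ≤ degIn G B v
  degIn-mono {A} A⊆B v = p⊆q⇒∣p∣≤∣q∣ λ x∈ → let x∈N , x∈A = x∈p∩q⁻ (N G v) A x∈ in x∈p∩q⁺ (x∈N , A⊆B x∈A)

  FTTD-nonempty : ∀ {m S} → 1 ≤ n → 1 ≤ m → FTTD G m S → 1 ≤ ∣ S ∣
  FTTD-nonempty {m} {S} (s≤s z≤n) 1≤m (dominated , _) with zero ∈? S
  ... | yes 0∈S = x∈p⇒1≤∣p∣ 0∈S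
  ... | no  0∉S = ≤-trans 1≤m (≤-trans (dominated zero 0∉S) (∣p∩q∣≤∣q∣ (N G zero) S))

  module _ (m₀ : ℕ) where

    F : Subset n → ℕ
    F = f G (suc m₀)

    coverageAt : Subset n → Fin n → ℕ
    coverageAt A v = coverage m₀ (lookup A v) (degIn G A v)

    mA≡coverageAt : ∀ A v → mA G (suc m₀) A v ≡ coverageAt A v
    mA≡coverageAt A v with lookup A v
    ... | false = if-≤ᵇ≡⊓ (suc m₀) (degIn G A v)
    ... | true with degIn G A v
    ...   | zero  = refl
    ...   | suc _ = refl

    F≡sum : ∀ A → F A ≡ sum (coverageAt A)
    F≡sum A = trans (foldr-+-map-tabulate (mA G (suc m₀) A) id) (sum-cong-≗ (mA≡coverageAt A))

    coverageAt-∉ : ∀ {A u} → u ∉ A → coverageAt A u ≡ coverage m₀ false (degIn G A u)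
    coverageAt-∉ {A} {u} u∉A = cong (λ b → coverage m₀ b (degIn G A u)) (∉⇒lookup≡false u∉A)

    coverageAt-∪⁅⁆-≢ : ∀ {A u v} → u ∉ A → v ≢ u →
                       coverageAt (A ∪ ⁅ u ⁆) v ≡ coverage m₀ (lookup A v) (toℕ (adj G v u) + degIn G A v)
    coverageAt-∪⁅⁆-≢ {A} u∉A v≢u = cong₂ (coverage m₀) (lookup-∪⁅x⁆-≢ A v≢u) (degIn-∪⁅⁆ u∉A _)

    coverageAt-∪⁅⁆-self : ∀ {A u} → u ∉ A → coverageAt (A ∪ ⁅ u ⁆) u ≡ coverage m₀ true (degIn G A u)
    coverageAt-∪⁅⁆-self {A} {u} u∉A = cong₂ (coverage m₀) (lookup-∪⁅x⁆-x A u)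
      (trans (degIn-∪⁅⁆ u∉A u) (cong (λ b → toℕ b + degIn G A u) (irrefl G u)))

    coverageAt-mono : ∀ {A B} → A ⊆ B → ∀ v → coverageAt A v ≤ coverageAt B v
    coverageAt-mono A⊆B v = coverage-mono m₀ (⊆⇒lookup-≤ A⊆B v) (degIn-mono A⊆B v)

    coverageAt-submodular : ∀ {A B u} → A ⊆ B → u ∉ B → ∀ v →
      coverageAt A v + coverageAt (B ∪ ⁅ u ⁆) v ≤ coverageAt (A ∪ ⁅ u ⁆) v + coverageAt B v
    coverageAt-submodular {A} {B} {u} A⊆B u∉B v with v ≟ u
    ... | yes refl = begin
      coverageAt A u + coverageAt (B ∪ ⁅ u ⁆) u
        ≡⟨ cong₂ _+_ (coverageAt-∉ u∉A) (coverageAt-∪⁅⁆-self u∉B) ⟩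
      coverage m₀ false (degIn G A u) + coverage m₀ true (degIn G B u)
        ≤⟨ coverage-submodular-self m₀ (degIn-mono A⊆B u) ⟩
      coverage m₀ true (degIn G A u) + coverage m₀ false (degIn G B u)
        ≡⟨ cong₂ _+_ (coverageAt-∪⁅⁆-self u∉A) (coverageAt-∉ u∉B) ⟨
      coverageAt (A ∪ ⁅ u ⁆) u + coverageAt B u
        ∎
      where
      open ≤-Reasoning
      u∉A = u∉B ∘ A⊆B
    ... | no v≢u = begin
      coverageAt A v + coverageAt (B ∪ ⁅ u ⁆) v
        ≡⟨ cong (coverageAt A v +_) (coverageAt-∪⁅⁆-≢ u∉B v≢u) ⟩
      coverageAt A v + coverage m₀ (lookup B v) (toℕ (adj G v u) + degIn G B v)
        ≤⟨ coverage-submodular m₀ (⊆⇒lookup-≤ A⊆B v) (degIn-mono A⊆B v) (adj G v u) ⟩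
      coverage m₀ (lookup A v) (toℕ (adj G v u) + degIn G A v) + coverageAt B v
        ≡⟨ cong (_+ coverageAt B v) (coverageAt-∪⁅⁆-≢ (u∉B ∘ A⊆B) v≢u) ⟨
      coverageAt (A ∪ ⁅ u ⁆) v + coverageAt B v
        ∎
      where open ≤-Reasoning

    coverageAt-saturated : ∀ {S B} → FTTD G (suc m₀) S → S ⊆ B → ∀ v → coverageAt B v ≡ suc m₀
    coverageAt-saturated {S} {B} (dominated , total) S⊆B v =
      coverage-saturated m₀ (lookup B v) (≤-trans 1≤degIn (degIn-mono S⊆B v)) m≤degIn
      where
      1≤degIn : 1 ≤ degIn G S v
      1≤degIn with v ∈? S
      ... | yes v∈S = total v v∈S
      ... | no  v∉S = ≤-trans (s≤s z≤n) (dominated v v∉S)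
      m≤degIn : lookup B v ≡ false → suc m₀ ≤ degIn G B v
      m≤degIn v∉B = ≤-trans (dominated v (lookup≡false⇒∉ v∉B ∘ S⊆B)) (degIn-mono S⊆B v)

    F-strict : ∀ {A B} → A ⊆ B → ∀ v → coverageAt A v < coverageAt B v → F A < F B
    F-strict {A} {B} A⊆B v lt =
      subst₂ _<_ (sym (F≡sum A)) (sym (F≡sum B)) (sum-mono-< (coverageAt-mono A⊆B) v lt)

    F-submodular : ∀ {A B u} → A ⊆ B → u ∉ B → F A + F (B ∪ ⁅ u ⁆) ≤ F (A ∪ ⁅ u ⁆) + F B
    F-submodular {A} {B} {u} A⊆B u∉B =
      subst₂ _≤_ (sym (cong₂ _+_ (F≡sum A) (F≡sum (B ∪ ⁅ u ⁆)))) (sym (cong₂ _+_ (F≡sum (A ∪ ⁅ u ⁆)) (F≡sum B)))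
        (sum-+-mono-≤ (coverageAt-submodular A⊆B u∉B))

    F-≤ : ∀ A → F A ≤ n * suc m₀
    F-≤ A = subst₂ _≤_ (sym (F≡sum A)) (sum-const n (suc m₀))
      (sum-mono-≤ λ v → coverage-≤ m₀ (lookup A v) (degIn G A v))

    F-saturated : ∀ {S B} → FTTD G (suc m₀) S → S ⊆ B → F B ≡ n * suc m₀
    F-saturated {B = B} S-FTTD S⊆B =
      trans (F≡sum B) (trans (sum-cong-≗ (coverageAt-saturated S-FTTD S⊆B)) (sum-const n (suc m₀)))

    F-⁅⁆ : ∀ u → F (∅ ∪ ⁅ u ⁆) ≤ deg G u + m₀
    F-⁅⁆ u = begin
      F (∅ ∪ ⁅ u ⁆)
        ≡⟨ F≡sum (∅ ∪ ⁅ u ⁆) ⟩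
      sum (coverageAt (∅ ∪ ⁅ u ⁆))
        ≤⟨ sum-mono-≤ coverage≤ ⟩
      sum (λ v → toℕ (lookup (N G u) v) + toℕ (lookup ⁅ u ⁆ v) * m₀)
        ≡⟨ ∑-distrib-+ (toℕ ∘ lookup (N G u)) (λ v → toℕ (lookup ⁅ u ⁆ v) * m₀) ⟩
      sum (toℕ ∘ lookup (N G u)) + sum (λ v → toℕ (lookup ⁅ u ⁆ v) * m₀)
        ≡⟨ cong₂ _+_ (∣p∣≡sum (N G u)) (*-distribʳ-sum m₀ (toℕ ∘ lookup ⁅ u ⁆)) ⟨
      deg G u + sum (toℕ ∘ lookup ⁅ u ⁆) * m₀
        ≡⟨ cong (λ k → deg G u + k * m₀) (trans (sym (∣p∣≡sum ⁅ u ⁆)) (∣⁅x⁆∣≡1 u)) ⟩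
      deg G u + 1 * m₀
        ≡⟨ cong (deg G u +_) (*-identityˡ m₀) ⟩
      deg G u + m₀
        ∎
      where
      open ≤-Reasoning
      coverage≤ : ∀ v → coverageAt (∅ ∪ ⁅ u ⁆) v ≤ toℕ (lookup (N G u) v) + toℕ (lookup ⁅ u ⁆ v) * m₀
      coverage≤ v with v ≟ u
      ... | yes refl = begin
        coverageAt (∅ ∪ ⁅ u ⁆) u
          ≡⟨ trans (coverageAt-∪⁅⁆-self ∉⊥) (cong (coverage m₀ true) (degIn-∅ u)) ⟩
        m₀
          ≡⟨ *-identityˡ m₀ ⟨
        1 * m₀
          ≡⟨ cong (λ b → toℕ b * m₀) ([]=⇒lookup (x∈⁅x⁆ u)) ⟨
        toℕ (lookup ⁅ u ⁆ u) * m₀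
          ≤⟨ m≤n+m _ _ ⟩
        toℕ (lookup (N G u) u) + toℕ (lookup ⁅ u ⁆ u) * m₀
          ∎
      ... | no v≢u = begin
        coverageAt (∅ ∪ ⁅ u ⁆) v                             ≡⟨ coverageAt-∪⁅⁆-≢ ∉⊥ v≢u ⟩
        coverage m₀ (lookup ∅ v) (toℕ (adj G v u) + degIn G ∅ v)
          ≡⟨ cong₂ (λ b d → coverage m₀ b (toℕ (adj G v u) + d)) (lookup-replicate v outside) (degIn-∅ v) ⟩
        suc m₀ ⊓ (toℕ (adj G v u) + 0)                       ≤⟨ m⊓n≤n (suc m₀) _ ⟩
        toℕ (adj G v u) + 0
          ≡⟨ cong₂ (λ b c → toℕ b + toℕ c * m₀) (trans (adj-sym G v u) (sym (lookup∘tabulate (adj G u) v)))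
                                                  (sym (∉⇒lookup≡false (v≢u ∘ x∈⁅y⁆⇒x≡y u))) ⟩
        toℕ (lookup (N G u) v) + toℕ (lookup ⁅ u ⁆ v) * m₀  ∎

    gain-≤-gain⇒ : ∀ {A u x} → gain G (suc m₀) A u ℤ.≤ gain G (suc m₀) A x → F (A ∪ ⁅ u ⁆) ≤ F (A ∪ ⁅ x ⁆)
    gain-≤-gain⇒ {A} {u} {x} = [+a]-[+c]≤[+b]-[+c]⇒a≤b (F (A ∪ ⁅ u ⁆)) (F (A ∪ ⁅ x ⁆)) (F A)

    gain-≤0⇒ : ∀ {A u} → gain G (suc m₀) A u ℤ.≤ ℤ.+ 0 → F (A ∪ ⁅ u ⁆) ≤ F A
    gain-≤0⇒ {A} {u} = [+a]-[+b]≤0⇒a≤b (F (A ∪ ⁅ u ⁆)) (F A)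

    0<gain⇒ : ∀ {A u} → ℤ.+ 0 ℤ.< gain G (suc m₀) A u → F A < F (A ∪ ⁅ u ⁆)
    0<gain⇒ {A} {u} = 0<[+a]-[+b]⇒b<a (F (A ∪ ⁅ u ⁆)) (F A)

    Stuck : Subset n → Set
    Stuck S = ∀ u → u ∉ S → F (S ∪ ⁅ u ⁆) ≤ F S

    module _ {S} (noIsolated : NoIsolated G) (stuck : Stuck S) where

      stuck-improvable : ∀ {u} → u ∉ S → ∀ v → coverageAt S v < coverageAt (S ∪ ⁅ u ⁆) v → ⊥
      stuck-improvable {u} u∉S v lt = <⇒≱ (F-strict {S} (p⊆p∪q ⁅ u ⁆) v lt) (stuck u u∉S)

      stuck⇒1≤degIn : ∀ v → 1 ≤ degIn G S v
      stuck⇒1≤degIn v with degIn G S v in d≡ | noIsolated v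
      ... | suc _ | _      = s≤s z≤n
      ... | zero  | w , vw with w ∈? S
      ...   | yes w∈S = contradiction (subst (1 ≤_) d≡ (x∈p⇒1≤∣p∣ (x∈p∩q⁺ (adj⇒∈N vw , w∈S)))) λ ()
      ...   | no  w∉S = ⊥-elim (stuck-improvable w∉S v (begin-strict
        coverageAt S v                           ≡⟨ cong (coverage m₀ (lookup S v)) d≡ ⟩
        coverage m₀ (lookup S v) 0               <⟨ coverage-0<1 m₀ (lookup S v) ⟩
        coverage m₀ (lookup S v) (toℕ true + 0)  ≡⟨ cong₂ (λ b d → coverage m₀ (lookup S v) (toℕ b + d)) vw d≡ ⟨
        coverage m₀ (lookup S v) (toℕ (adj G v w) + degIn G S v) ≡⟨ coverageAt-∪⁅⁆-≢ w∉S (adj⇒≢ vw) ⟨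
        coverageAt (S ∪ ⁅ w ⁆) v                                 ∎))
        where open ≤-Reasoning

      stuck⇒FTTD : FTTD G (suc m₀) S
      stuck⇒FTTD = dominated , λ v _ → stuck⇒1≤degIn v
        where
        dominated : ∀ v → v ∉ S → suc m₀ ≤ degIn G S v
        dominated v v∉S with suc m₀ ≤? degIn G S v
        ... | yes m≤d = m≤d
        ... | no  m≰d with degIn G S v in d≡ | stuck⇒1≤degIn v
        ...   | suc d | _ = ⊥-elim (stuck-improvable v∉S v (begin-strict
          coverageAt S v             ≡⟨ trans (coverageAt-∉ v∉S) (cong (coverage m₀ false) d≡) ⟩
          coverage m₀ false (suc d)  <⟨ coverage-false<true m₀ d (≰⇒> m≰d) ⟩
          coverage m₀ true (suc d)   ≡⟨ trans (coverageAt-∪⁅⁆-self v∉S) (cong (coverage m₀ true) d≡) ⟨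
          coverageAt (S ∪ ⁅ v ⁆) v   ∎))
          where open ≤-Reasoning

    GainsBoundedBy : Subset n → ℕ → Set
    GainsBoundedBy A g = ∀ u → u ∉ A → F (A ∪ ⁅ u ⁆) ≤ F A + g

    gainsBoundedBy-⊆ : ∀ {A B g} → A ⊆ B → GainsBoundedBy A g → GainsBoundedBy B g
    gainsBoundedBy-⊆ {A} {B} {g} A⊆B bounded u u∉B = +-cancelˡ-≤ (F A) _ _ (begin
      F A + F (B ∪ ⁅ u ⁆)  ≤⟨ F-submodular A⊆B u∉B ⟩
      F (A ∪ ⁅ u ⁆) + F B  ≤⟨ +-monoˡ-≤ (F B) (bounded u (u∉B ∘ A⊆B)) ⟩
      F A + g + F B        ≡⟨ +-assoc (F A) g (F B) ⟩
      F A + (g + F B)      ≡⟨ cong (F A +_) (+-comm g (F B)) ⟩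
      F A + (F B + g)      ∎)
      where open ≤-Reasoning

    gainsBoundedBy⇒ : ∀ {A g} → GainsBoundedBy A g → ∀ u → F (A ∪ ⁅ u ⁆) ≤ F A + g
    gainsBoundedBy⇒ {A} {g} bounded u with u ∈? A
    ... | yes u∈A = ≤-trans (≤-reflexive (cong F (x∈p⇒p∪⁅x⁆≡p u∈A))) (m≤m+n (F A) g)
    ... | no  u∉A = bounded u u∉A

    F-∪-fromList : ∀ {A g} → GainsBoundedBy A g → ∀ Y → F (A ∪ fromList Y) ≤ F A + length Y * g
    F-∪-fromList {A} {g} bounded []      = ≤-trans (≤-reflexive (cong F (∪-identityʳ A))) (m≤m+n (F A) 0)
    F-∪-fromList {A} {g} bounded (y ∷ Y) = begin
      F (A ∪ (fromList Y ∪ ⁅ y ⁆))  ≡⟨ cong F (∪-assoc A (fromList Y) ⁅ y ⁆) ⟨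
      F ((A ∪ fromList Y) ∪ ⁅ y ⁆)  ≤⟨ gainsBoundedBy⇒ (gainsBoundedBy-⊆ {A} (p⊆p∪q (fromList Y)) bounded) y ⟩
      F (A ∪ fromList Y) + g        ≤⟨ +-monoˡ-≤ g (F-∪-fromList bounded Y) ⟩
      F A + length Y * g + g        ≡⟨ +-assoc (F A) (length Y * g) g ⟩
      F A + (length Y * g + g)      ≡⟨ cong (F A +_) (+-comm (length Y * g) g) ⟩
      F A + (g + length Y * g)      ∎
      where open ≤-Reasoning

    F-∪ : ∀ {A g} → GainsBoundedBy A g → ∀ T → F (A ∪ T) ≤ F A + ∣ T ∣ * g
    F-∪ {A} {g} bounded T = subst₂ (λ U k → F (A ∪ U) ≤ F A + k * g) (fromList-elements T) (length-elements T)
      (F-∪-fromList bounded (elements T))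

    deficit : Subset n → ℕ
    deficit A = n * suc m₀ ∸ F A

    deficit-≤ : ∀ {A g S} → FTTD G (suc m₀) S → GainsBoundedBy A g → deficit A ≤ ∣ S ∣ * g
    deficit-≤ {A} {g} {S} S-FTTD bounded = begin
      n * suc m₀ ∸ F A       ≡⟨ cong (_∸ F A) (F-saturated S-FTTD (q⊆p∪q A S)) ⟨
      F (A ∪ S) ∸ F A        ≤⟨ ∸-monoˡ-≤ (F A) (F-∪ bounded S) ⟩
      F A + ∣ S ∣ * g ∸ F A  ≡⟨ m+n∸m≡n (F A) (∣ S ∣ * g) ⟩
      ∣ S ∣ * g              ∎
      where open ≤-Reasoning

    deficit-∪⁅⁆ : ∀ {A x k} → F (A ∪ ⁅ x ⁆) ≡ F A + k → deficit A ≡ deficit (A ∪ ⁅ x ⁆) + k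
    deficit-∪⁅⁆ {A} {x} {k} F[A∪x]≡ = begin
      n * suc m₀ ∸ F A                ≡⟨ m∸n+n≡m k≤deficit ⟨
      n * suc m₀ ∸ F A ∸ k + k        ≡⟨ cong (_+ k) (∸-+-assoc (n * suc m₀) (F A) k) ⟩
      n * suc m₀ ∸ (F A + k) + k      ≡⟨ cong (λ a → n * suc m₀ ∸ a + k) F[A∪x]≡ ⟨
      n * suc m₀ ∸ F (A ∪ ⁅ x ⁆) + k  ∎
      where
      open ≡-Reasoning
      k≤deficit : k ≤ n * suc m₀ ∸ F A
      k≤deficit = subst (_≤ n * suc m₀ ∸ F A) (m+n∸m≡n (F A) k)
        (∸-monoˡ-≤ (F A) (subst (_≤ n * suc m₀) F[A∪x]≡ (F-≤ (A ∪ ⁅ x ⁆))))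

    greedy-step-gain : ∀ {A x} → (∃ λ u → u ∉ A × ℤ.+ 0 ℤ.< gain G (suc m₀) A u) →
                       (∀ u → u ∉ A → gain G (suc m₀) A u ℤ.≤ gain G (suc m₀) A x) →
                       ∃ λ g → F (A ∪ ⁅ x ⁆) ≡ F A + suc g × GainsBoundedBy A (suc g)
    greedy-step-gain {A} {x} (u , u∉A , 0<gain) x-max = F (A ∪ ⁅ x ⁆) ∸ suc (F A) , F[A∪x]≡ , bounded
      where
      F[A∪x]≡ : F (A ∪ ⁅ x ⁆) ≡ F A + suc (F (A ∪ ⁅ x ⁆) ∸ suc (F A))
      F[A∪x]≡ = trans (sym (m+[n∸m]≡n (<-≤-trans (0<gain⇒ {A} 0<gain) (gain-≤-gain⇒ {A} {u} (x-max u u∉A)))))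
                      (sym (+-suc (F A) _))
      bounded : GainsBoundedBy A (suc (F (A ∪ ⁅ x ⁆) ∸ suc (F A)))
      bounded v v∉A = ≤-trans (gain-≤-gain⇒ {A} {v} (x-max v v∉A)) (≤-reflexive F[A∪x]≡)

    gains-from-∅ : GainsBoundedBy ∅ (maxDeg G + m₀)
    gains-from-∅ u _ = ≤-trans (F-⁅⁆ u) (≤-trans (+-monoˡ-≤ m₀ (deg≤maxDeg u)) (m≤n+m _ (F ∅)))

-- Rational arithmetic and the exponential series

fromℕ : ℕ → ℚᵘ
fromℕ a = mkℚᵘ (ℤ.+ a) 0

1/[1+_] : ℕ → ℚᵘ
1/[1+ d ] = mkℚᵘ (ℤ.+ 1) d

0≤fromℕ : ∀ a → 0ℚᵘ ≤ᵘ fromℕ a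
0≤fromℕ a = ℚ.nonNegative⁻¹ (fromℕ a)

0≤1/[1+] : ∀ d → 0ℚᵘ ≤ᵘ 1/[1+ d ]
0≤1/[1+] d = ℚ.nonNegative⁻¹ 1/[1+ d ]

0≤+ : ∀ {p q} → 0ℚᵘ ≤ᵘ p → 0ℚᵘ ≤ᵘ q → 0ℚᵘ ≤ᵘ p +ᵘ q
0≤+ {p} {q} 0≤p 0≤q = ℚ.nonNegative⁻¹ _ {{ℚ.nonNeg+nonNeg⇒nonNeg p {{nonNegative 0≤p}} q {{nonNegative 0≤q}}}}

0≤* : ∀ {p q} → 0ℚᵘ ≤ᵘ p → 0ℚᵘ ≤ᵘ q → 0ℚᵘ ≤ᵘ p *ᵘ q
0≤* {p} {q} 0≤p 0≤q = ℚ.nonNegative⁻¹ _ {{ℚ.nonNeg*nonNeg⇒nonNeg p {{nonNegative 0≤p}} q {{nonNegative 0≤q}}}}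

*-monoˡ-≤-nonNeg′ : ∀ {r p q} → 0ℚᵘ ≤ᵘ r → p ≤ᵘ q → p *ᵘ r ≤ᵘ q *ᵘ r
*-monoˡ-≤-nonNeg′ {r} 0≤r = ℚ.*-monoˡ-≤-nonNeg r {{nonNegative 0≤r}}

*-monoʳ-≤-nonNeg′ : ∀ {r p q} → 0ℚᵘ ≤ᵘ r → p ≤ᵘ q → r *ᵘ p ≤ᵘ r *ᵘ q
*-monoʳ-≤-nonNeg′ {r} 0≤r = ℚ.*-monoʳ-≤-nonNeg r {{nonNegative 0≤r}}

p≤p+q′ : ∀ {p q} → 0ℚᵘ ≤ᵘ q → p ≤ᵘ p +ᵘ q
p≤p+q′ {p} {q} 0≤q = ℚ.p≤p+q p q {{nonNegative 0≤q}}

+ᵘ-cancelʳ-≤ : ∀ {r p q} → p +ᵘ r ≤ᵘ q +ᵘ r → p ≤ᵘ q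
+ᵘ-cancelʳ-≤ {r} {p} {q} p+r≤q+r = begin
  p               ≃⟨ solve 2 (λ p r → p := (p :+ r) :- r) ℚ.≃-refl p r ⟩
  (p +ᵘ r) ℚ.- r  ≤⟨ ℚ.+-monoˡ-≤ (ℚ.- r) p+r≤q+r ⟩
  (q +ᵘ r) ℚ.- r  ≃⟨ solve 2 (λ q r → (q :+ r) :- r := q) ℚ.≃-refl q r ⟩
  q               ∎
  where open ℚ.≤-Reasoning

fromℕ-+ : ∀ a b → fromℕ (a + b) ≃ᵘ fromℕ a +ᵘ fromℕ b
fromℕ-+ a b = *≡* (cong (ℤ._* ℤ.+ 1)
  (trans (ℤ.pos-+ a b) (sym (cong₂ ℤ._+_ (ℤ.*-identityʳ (ℤ.+ a)) (ℤ.*-identityʳ (ℤ.+ b))))))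

fromℕ-suc : ∀ a → fromℕ (suc a) ≃ᵘ 1ℚᵘ +ᵘ fromℕ a
fromℕ-suc = fromℕ-+ 1

fromℕ[1+d]*1/[1+d] : ∀ d → fromℕ (suc d) *ᵘ 1/[1+ d ] ≃ᵘ 1ℚᵘ
fromℕ[1+d]*1/[1+d] d = ℚ.*-inverseʳ (fromℕ (suc d))

mkℚᵘ≃fromℕ*1/[1+] : ∀ a d → mkℚᵘ (ℤ.+ a) d ≃ᵘ fromℕ a *ᵘ 1/[1+ d ]
mkℚᵘ≃fromℕ*1/[1+] a d = *≡* (trans (cong (λ t → ℤ.+ a ℤ.* ℤ.+ suc t) (+-identityʳ d))
  (cong (ℤ._* ℤ.+ suc d) (sym (ℤ.*-identityʳ (ℤ.+ a)))))

fraction-≤ : ∀ {p q d e} → p * suc e ≤ q * suc d → mkℚᵘ (ℤ.+ p) d ≤ᵘ mkℚᵘ (ℤ.+ q) e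
fraction-≤ {p} {q} {d} {e} le = *≤* (subst₂ ℤ._≤_ (ℤ.pos-* p (suc e)) (ℤ.pos-* q (suc d)) (ℤ.+≤+ le))

fromℕ*1/[1+]-≤ : ∀ {p q d e} → p * suc e ≤ q * suc d → fromℕ p *ᵘ 1/[1+ d ] ≤ᵘ fromℕ q *ᵘ 1/[1+ e ]
fromℕ*1/[1+]-≤ {p} {q} {d} {e} le = begin
  fromℕ p *ᵘ 1/[1+ d ]  ≃⟨ mkℚᵘ≃fromℕ*1/[1+] p d ⟨
  mkℚᵘ (ℤ.+ p) d        ≤⟨ fraction-≤ le ⟩
  mkℚᵘ (ℤ.+ q) e        ≃⟨ mkℚᵘ≃fromℕ*1/[1+] q e ⟩
  fromℕ q *ᵘ 1/[1+ e ]  ∎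
  where open ℚ.≤-Reasoning

r≤b[1+g]⇒r[2+g]≤[r+b][1+g] : ∀ {r b g} → r ≤ b * suc g → r * suc (suc g) ≤ (r + b) * suc g
r≤b[1+g]⇒r[2+g]≤[r+b][1+g] {r} {b} {g} r≤b[1+g] = begin
  r * suc (suc g)        ≡⟨ *-suc r (suc g) ⟩
  r + r * suc g          ≤⟨ +-monoˡ-≤ (r * suc g) r≤b[1+g] ⟩
  b * suc g + r * suc g  ≡⟨ *-distribʳ-+ (suc g) b r ⟨
  (b + r) * suc g        ≡⟨ cong (_* suc g) (+-comm b r) ⟩
  (r + b) * suc g        ∎
  where open ≤-Reasoning

expTerm-nonNeg : ∀ {x} → 0ℚᵘ ≤ᵘ x → ∀ i → 0ℚᵘ ≤ᵘ expTerm x i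
expTerm-nonNeg 0≤x zero    = ℚ.nonNegative⁻¹ 1ℚᵘ
expTerm-nonNeg 0≤x (suc i) = 0≤* (0≤* (expTerm-nonNeg 0≤x i) 0≤x) (0≤1/[1+] i)

expTerm-mono : ∀ {x x′} → 0ℚᵘ ≤ᵘ x → x ≤ᵘ x′ → ∀ i → expTerm x i ≤ᵘ expTerm x′ i
expTerm-mono 0≤x x≤x′ zero    = ℚ.≤-refl
expTerm-mono {x} {x′} 0≤x x≤x′ (suc i) = *-monoˡ-≤-nonNeg′ (0≤1/[1+] i) (begin
  expTerm x i *ᵘ x    ≤⟨ *-monoˡ-≤-nonNeg′ 0≤x (expTerm-mono 0≤x x≤x′ i) ⟩
  expTerm x′ i *ᵘ x   ≤⟨ *-monoʳ-≤-nonNeg′ (expTerm-nonNeg (ℚ.≤-trans 0≤x x≤x′) i) x≤x′ ⟩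
  expTerm x′ i *ᵘ x′  ∎)
  where open ℚ.≤-Reasoning

expPartial-mono : ∀ {x x′} → 0ℚᵘ ≤ᵘ x → x ≤ᵘ x′ → ∀ N → expPartial x N ≤ᵘ expPartial x′ N
expPartial-mono 0≤x x≤x′ zero    = ℚ.≤-refl
expPartial-mono 0≤x x≤x′ (suc N) = ℚ.+-mono-≤ (expPartial-mono 0≤x x≤x′ N) (expTerm-mono 0≤x x≤x′ (suc N))

expTerm-suc*fromℕ : ∀ z j → expTerm z (suc j) *ᵘ fromℕ (suc j) ≃ᵘ expTerm z j *ᵘ z
expTerm-suc*fromℕ z j = begin-equality
  expTerm z j *ᵘ z *ᵘ 1/[1+ j ] *ᵘ fromℕ (suc j)
    ≃⟨ ℚ.*-assoc (expTerm z j *ᵘ z) 1/[1+ j ] (fromℕ (suc j)) ⟩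
  expTerm z j *ᵘ z *ᵘ (1/[1+ j ] *ᵘ fromℕ (suc j))
    ≃⟨ ℚ.*-congˡ {expTerm z j *ᵘ z} (ℚ.≃-trans (ℚ.*-comm 1/[1+ j ] (fromℕ (suc j))) (fromℕ[1+d]*1/[1+d] j)) ⟩
  expTerm z j *ᵘ z *ᵘ 1ℚᵘ
    ≃⟨ ℚ.*-identityʳ (expTerm z j *ᵘ z) ⟩
  expTerm z j *ᵘ z
    ∎
  where open ℚ.≤-Reasoning

expTerm-shift : ∀ {x y} → 0ℚᵘ ≤ᵘ x → 0ℚᵘ ≤ᵘ y → ∀ i →
                expTerm (x +ᵘ y) (suc i) ≤ᵘ expTerm x (suc i) +ᵘ y *ᵘ expTerm (x +ᵘ y) i
expTerm-shift {x} {y} _ _ zero = ℚ.≤-reflexive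
  (solve 2 (λ x y → (con 1ℚᵘ :* (x :+ y)) :* con 1ℚᵘ := (con 1ℚᵘ :* x) :* con 1ℚᵘ :+ y :* con 1ℚᵘ) ℚ.≃-refl x y)
expTerm-shift {x} {y} 0≤x 0≤y (suc j) = begin
  zʲ⁺¹ *ᵘ z *ᵘ w
    ≃⟨ ℚ.*-congʳ {w} (solve 3 (λ a x y → a :* (x :+ y) := a :* x :+ a :* y) ℚ.≃-refl zʲ⁺¹ x y) ⟩
  (zʲ⁺¹ *ᵘ x +ᵘ zʲ⁺¹ *ᵘ y) *ᵘ w
    ≤⟨ *-monoˡ-≤-nonNeg′ (0≤1/[1+] (suc j)) (ℚ.+-monoˡ-≤ (zʲ⁺¹ *ᵘ y) zʲ⁺¹x≤) ⟩
  (xʲ⁺¹ *ᵘ x +ᵘ y *ᵘ (zʲ⁺¹ *ᵘ fromℕ (suc j)) +ᵘ zʲ⁺¹ *ᵘ y) *ᵘ w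
    ≃⟨ solve 6 (λ a b x y c u → (a :* x :+ y :* (b :* c) :+ b :* y) :* u
                                := (a :* x) :* u :+ y :* b :* ((con 1ℚᵘ :+ c) :* u))
         ℚ.≃-refl xʲ⁺¹ zʲ⁺¹ x y (fromℕ (suc j)) w ⟩
  xʲ⁺¹ *ᵘ x *ᵘ w +ᵘ y *ᵘ zʲ⁺¹ *ᵘ ((1ℚᵘ +ᵘ fromℕ (suc j)) *ᵘ w)
    ≃⟨ ℚ.+-congʳ (xʲ⁺¹ *ᵘ x *ᵘ w) (ℚ.*-congˡ {y *ᵘ zʲ⁺¹} (ℚ.≃-trans (ℚ.*-congʳ {w} (ℚ.≃-sym (fromℕ-suc (suc j))))
                                                                    (fromℕ[1+d]*1/[1+d] (suc j)))) ⟩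
  xʲ⁺¹ *ᵘ x *ᵘ w +ᵘ y *ᵘ zʲ⁺¹ *ᵘ 1ℚᵘ
    ≃⟨ ℚ.+-congʳ (xʲ⁺¹ *ᵘ x *ᵘ w) (ℚ.*-identityʳ (y *ᵘ zʲ⁺¹)) ⟩
  xʲ⁺¹ *ᵘ x *ᵘ w +ᵘ y *ᵘ zʲ⁺¹
    ∎
  where
  open ℚ.≤-Reasoning
  z = x +ᵘ y
  w = 1/[1+ suc j ]
  zʲ = expTerm z j
  zʲ⁺¹ = expTerm z (suc j)
  xʲ⁺¹ = expTerm x (suc j)
  zʲ⁺¹x≤ : zʲ⁺¹ *ᵘ x ≤ᵘ xʲ⁺¹ *ᵘ x +ᵘ y *ᵘ (zʲ⁺¹ *ᵘ fromℕ (suc j))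
  zʲ⁺¹x≤ = begin
    zʲ⁺¹ *ᵘ x
      ≤⟨ *-monoˡ-≤-nonNeg′ 0≤x (expTerm-shift 0≤x 0≤y j) ⟩
    (xʲ⁺¹ +ᵘ y *ᵘ zʲ) *ᵘ x
      ≃⟨ solve 4 (λ a b x y → (a :+ y :* b) :* x := a :* x :+ y :* b :* x) ℚ.≃-refl xʲ⁺¹ zʲ x y ⟩
    xʲ⁺¹ *ᵘ x +ᵘ y *ᵘ zʲ *ᵘ x
      ≤⟨ ℚ.+-monoʳ-≤ (xʲ⁺¹ *ᵘ x) (*-monoʳ-≤-nonNeg′ (0≤* 0≤y (expTerm-nonNeg (0≤+ 0≤x 0≤y) j)) (p≤p+q′ 0≤y)) ⟩
    xʲ⁺¹ *ᵘ x +ᵘ y *ᵘ zʲ *ᵘ z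
      ≃⟨ ℚ.+-congʳ (xʲ⁺¹ *ᵘ x) (ℚ.≃-trans (ℚ.*-assoc y zʲ z) (ℚ.*-congˡ {y} (ℚ.≃-sym (expTerm-suc*fromℕ z j)))) ⟩
    xʲ⁺¹ *ᵘ x +ᵘ y *ᵘ (zʲ⁺¹ *ᵘ fromℕ (suc j))
      ∎

expPartial-shift-suc : ∀ {x y} → 0ℚᵘ ≤ᵘ x → 0ℚᵘ ≤ᵘ y → ∀ N →
                       expPartial (x +ᵘ y) (suc N) ≤ᵘ expPartial x (suc N) +ᵘ y *ᵘ expPartial (x +ᵘ y) N
expPartial-shift-suc {x} {y} 0≤x 0≤y zero = ℚ.≤-trans (ℚ.+-monoʳ-≤ 1ℚᵘ (expTerm-shift 0≤x 0≤y 0))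
  (ℚ.≤-reflexive (solve 3 (λ a b c → con 1ℚᵘ :+ (a :+ b :* c) := (con 1ℚᵘ :+ a) :+ b :* c) ℚ.≃-refl (expTerm x 1) y 1ℚᵘ))
expPartial-shift-suc {x} {y} 0≤x 0≤y (suc N) =
  ℚ.≤-trans (ℚ.+-mono-≤ (expPartial-shift-suc 0≤x 0≤y N) (expTerm-shift 0≤x 0≤y (suc N)))
    (ℚ.≤-reflexive (solve 5 (λ a b c d y → (a :+ y :* b) :+ (c :+ y :* d) := (a :+ c) :+ y :* (b :+ d)) ℚ.≃-refl
      (expPartial x (suc N)) (expPartial (x +ᵘ y) N) (expTerm x (suc (suc N))) (expTerm (x +ᵘ y) (suc N)) y))

expPartial-≤-suc : ∀ {x} → 0ℚᵘ ≤ᵘ x → ∀ N → expPartial x N ≤ᵘ expPartial x (suc N)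
expPartial-≤-suc 0≤x N = p≤p+q′ (expTerm-nonNeg 0≤x (suc N))

-- the partial-sum form of e^(x+y) (1 − y) ≤ e^x
expPartial-shift : ∀ {x y} → 0ℚᵘ ≤ᵘ x → 0ℚᵘ ≤ᵘ y → ∀ N →
                   expPartial (x +ᵘ y) N ≤ᵘ expPartial x N +ᵘ y *ᵘ expPartial (x +ᵘ y) N
expPartial-shift 0≤x 0≤y zero    = p≤p+q′ (0≤* 0≤y (ℚ.nonNegative⁻¹ 1ℚᵘ))
expPartial-shift {x} 0≤x 0≤y (suc N) = ℚ.≤-trans (expPartial-shift-suc 0≤x 0≤y N)
  (ℚ.+-monoʳ-≤ (expPartial x (suc N)) (*-monoʳ-≤-nonNeg′ 0≤y (expPartial-≤-suc (0≤+ 0≤x 0≤y) N)))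

expPartial-0 : ∀ N → expPartial 0ℚᵘ N ≤ᵘ 1ℚᵘ
expPartial-0 zero    = ℚ.≤-refl
expPartial-0 (suc N) = ℚ.≤-trans (ℚ.+-mono-≤ (expPartial-0 N) (ℚ.≤-reflexive term≃0)) (ℚ.≤-reflexive (ℚ.+-identityʳ 1ℚᵘ))
  where
  term≃0 : expTerm 0ℚᵘ (suc N) ≃ᵘ 0ℚᵘ
  term≃0 = ℚ.≃-trans (ℚ.*-congʳ {1/[1+ N ]} (ℚ.*-zeroʳ (expTerm 0ℚᵘ N))) (ℚ.*-zeroˡ 1/[1+ N ])

-- harmonicTail g = 1/2 + ⋯ + 1/(g+1), the harmonic number H_{g+1} minus 1
harmonicTail : ℕ → ℚᵘ
harmonicTail zero    = 0ℚᵘ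
harmonicTail (suc g) = harmonicTail g +ᵘ 1/[1+ suc g ]

harmonicTail-nonNeg : ∀ g → 0ℚᵘ ≤ᵘ harmonicTail g
harmonicTail-nonNeg zero    = ℚ.≤-refl
harmonicTail-nonNeg (suc g) = 0≤+ (harmonicTail-nonNeg g) (0≤1/[1+] (suc g))

-- E ≤ K + E/(K + 1) for the partial sum E at harmonicTail K, hence E ≤ K + 1
exp-harmonicTail : ∀ g N → expPartial (harmonicTail g) N ≤ᵘ fromℕ (suc g)
exp-harmonicTail zero    N = expPartial-0 N
exp-harmonicTail (suc g) N = ℚ.*-cancelʳ-≤-pos (fromℕ K) (+ᵘ-cancelʳ-≤ (begin
  E *ᵘ fromℕ K +ᵘ E
    ≃⟨ solve 2 (λ e k → e :* k :+ e := e :* (con 1ℚᵘ :+ k)) ℚ.≃-refl E (fromℕ K) ⟩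
  E *ᵘ (1ℚᵘ +ᵘ fromℕ K)
    ≃⟨ ℚ.*-congˡ {E} (ℚ.≃-sym (fromℕ-suc K)) ⟩
  E *ᵘ fromℕ (suc K)
    ≤⟨ *-monoˡ-≤-nonNeg′ (0≤fromℕ (suc K)) E≤K+wE ⟩
  (fromℕ K +ᵘ w *ᵘ E) *ᵘ fromℕ (suc K)
    ≃⟨ solve 4 (λ k w e k₁ → (k :+ w :* e) :* k₁ := k₁ :* k :+ e :* (k₁ :* w)) ℚ.≃-refl (fromℕ K) w E (fromℕ (suc K)) ⟩
  fromℕ (suc K) *ᵘ fromℕ K +ᵘ E *ᵘ (fromℕ (suc K) *ᵘ w)
    ≃⟨ ℚ.+-congʳ (fromℕ (suc K) *ᵘ fromℕ K) (ℚ.≃-trans (ℚ.*-congˡ {E} (fromℕ[1+d]*1/[1+d] K)) (ℚ.*-identityʳ E)) ⟩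
  fromℕ (suc K) *ᵘ fromℕ K +ᵘ E
    ∎))
  where
  open ℚ.≤-Reasoning
  K = suc g
  w = 1/[1+ K ]
  E = expPartial (harmonicTail g +ᵘ w) N
  E≤K+wE : E ≤ᵘ fromℕ K +ᵘ w *ᵘ E
  E≤K+wE = ℚ.≤-trans (expPartial-shift (harmonicTail-nonNeg g) (0≤1/[1+] K) N) (ℚ.+-monoˡ-≤ (w *ᵘ E) (exp-harmonicTail g N))

-- Bounds the number of greedy steps still to come when f is r short of its maximum,
-- an optimal solution has b vertices and every gain is at most g + 1.
remainingBound : ℕ → ℕ → ℕ → ℚᵘ
remainingBound r b g = fromℕ r *ᵘ 1/[1+ g ] +ᵘ fromℕ b *ᵘ harmonicTail g

remainingBound-suc : ∀ {r b g} → r ≤ b * suc g → remainingBound r b g ≤ᵘ remainingBound r b (suc g)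
remainingBound-suc {r} {b} {g} r≤b[1+g] = begin
  fromℕ r *ᵘ 1/[1+ g ] +ᵘ fromℕ b *ᵘ H
    ≤⟨ ℚ.+-monoˡ-≤ (fromℕ b *ᵘ H) (fromℕ*1/[1+]-≤ {r} {r + b} (r≤b[1+g]⇒r[2+g]≤[r+b][1+g] {r} {b} r≤b[1+g])) ⟩
  fromℕ (r + b) *ᵘ w +ᵘ fromℕ b *ᵘ H
    ≃⟨ ℚ.+-congˡ (fromℕ b *ᵘ H) (ℚ.*-congʳ {w} (fromℕ-+ r b)) ⟩
  (fromℕ r +ᵘ fromℕ b) *ᵘ w +ᵘ fromℕ b *ᵘ H
    ≃⟨ solve 4 (λ r b w h → (r :+ b) :* w :+ b :* h := r :* w :+ b :* (h :+ w)) ℚ.≃-refl (fromℕ r) (fromℕ b) w H ⟩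
  fromℕ r *ᵘ w +ᵘ fromℕ b *ᵘ (H +ᵘ w)
    ∎
  where
  open ℚ.≤-Reasoning
  w = 1/[1+ suc g ]
  H = harmonicTail g

remainingBound-mono : ∀ {r b g₁ g} → r ≤ b * suc g₁ → g₁ ≤′ g → remainingBound r b g₁ ≤ᵘ remainingBound r b g
remainingBound-mono r≤b[1+g₁] ≤′-refl = ℚ.≤-refl
remainingBound-mono {r} {b} r≤b[1+g₁] (≤′-step {g} g₁≤′g) = ℚ.≤-trans (remainingBound-mono r≤b[1+g₁] g₁≤′g)
  (remainingBound-suc {r} {b} {g} (≤-trans r≤b[1+g₁] (*-monoʳ-≤ b (s≤s (≤′⇒≤ g₁≤′g)))))

remainingBound-step : ∀ a r b g → fromℕ (suc a) +ᵘ remainingBound r b g ≃ᵘ fromℕ a +ᵘ remainingBound (r + suc g) b g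
remainingBound-step a r b g = begin-equality
  fromℕ (suc a) +ᵘ (fromℕ r *ᵘ u +ᵘ fromℕ b *ᵘ H)
    ≃⟨ ℚ.+-congˡ (fromℕ r *ᵘ u +ᵘ fromℕ b *ᵘ H) (fromℕ-suc a) ⟩
  1ℚᵘ +ᵘ fromℕ a +ᵘ (fromℕ r *ᵘ u +ᵘ fromℕ b *ᵘ H)
    ≃⟨ ℚ.+-congˡ (fromℕ r *ᵘ u +ᵘ fromℕ b *ᵘ H) (ℚ.+-congˡ (fromℕ a) (fromℕ[1+d]*1/[1+d] g)) ⟨
  fromℕ (suc g) *ᵘ u +ᵘ fromℕ a +ᵘ (fromℕ r *ᵘ u +ᵘ fromℕ b *ᵘ H)
    ≃⟨ solve 6 (λ s u a r b h → s :* u :+ a :+ (r :* u :+ b :* h) := a :+ ((r :+ s) :* u :+ b :* h))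
         ℚ.≃-refl (fromℕ (suc g)) u (fromℕ a) (fromℕ r) (fromℕ b) H ⟩
  fromℕ a +ᵘ ((fromℕ r +ᵘ fromℕ (suc g)) *ᵘ u +ᵘ fromℕ b *ᵘ H)
    ≃⟨ ℚ.+-congʳ (fromℕ a) (ℚ.+-congˡ (fromℕ b *ᵘ H) (ℚ.*-congʳ {u} (fromℕ-+ r (suc g)))) ⟨
  fromℕ a +ᵘ (fromℕ (r + suc g) *ᵘ u +ᵘ fromℕ b *ᵘ H)
    ∎
  where
  open ℚ.≤-Reasoning
  u = 1/[1+ g ]
  H = harmonicTail g

fromℕ-∸-≤ : ∀ {a b h} → 0ℚᵘ ≤ᵘ h → fromℕ a ≤ᵘ fromℕ b *ᵘ (1ℚᵘ +ᵘ h) → fromℕ (a ∸ b) ≤ᵘ fromℕ b *ᵘ h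
fromℕ-∸-≤ {a} {b} {h} 0≤h a≤b[1+h] with b ≤? a
... | yes b≤a = +ᵘ-cancelʳ-≤ (begin
  fromℕ (a ∸ b) +ᵘ fromℕ b  ≃⟨ fromℕ-+ (a ∸ b) b ⟨
  fromℕ (a ∸ b + b)         ≡⟨ cong fromℕ (m∸n+n≡m b≤a) ⟩
  fromℕ a                   ≤⟨ a≤b[1+h] ⟩
  fromℕ b *ᵘ (1ℚᵘ +ᵘ h)     ≃⟨ solve 2 (λ b h → b :* (con 1ℚᵘ :+ h) := b :* h :+ b) ℚ.≃-refl (fromℕ b) h ⟩
  fromℕ b *ᵘ h +ᵘ fromℕ b   ∎)
  where open ℚ.≤-Reasoning
... | no  b≰a = ℚ.≤-trans (ℚ.≤-reflexive (ℚ.≃-reflexive (cong fromℕ (m≤n⇒m∸n≡0 (<⇒≤ (≰⇒> b≰a))))))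
                          (0≤* (0≤fromℕ b) 0≤h)

mkℚᵘ-≤ : ∀ {c d h} → fromℕ c ≤ᵘ fromℕ (suc d) *ᵘ h → mkℚᵘ (ℤ.+ c) d ≤ᵘ h
mkℚᵘ-≤ {c} {d} {h} c≤[1+d]h = ℚ.*-cancelʳ-≤-pos (fromℕ (suc d)) (begin
  mkℚᵘ (ℤ.+ c) d *ᵘ fromℕ (suc d)
    ≃⟨ ℚ.*-congʳ {fromℕ (suc d)} (mkℚᵘ≃fromℕ*1/[1+] c d) ⟩
  fromℕ c *ᵘ 1/[1+ d ] *ᵘ fromℕ (suc d)
    ≃⟨ solve 3 (λ c u s → c :* u :* s := c :* (s :* u)) ℚ.≃-refl (fromℕ c) 1/[1+ d ] (fromℕ (suc d)) ⟩
  fromℕ c *ᵘ (fromℕ (suc d) *ᵘ 1/[1+ d ])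
    ≃⟨ ℚ.≃-trans (ℚ.*-congˡ {fromℕ c} (fromℕ[1+d]*1/[1+d] d)) (ℚ.*-identityʳ (fromℕ c)) ⟩
  fromℕ c
    ≤⟨ c≤[1+d]h ⟩
  fromℕ (suc d) *ᵘ h
    ≃⟨ ℚ.*-comm (fromℕ (suc d)) h ⟩
  h *ᵘ fromℕ (suc d)
    ∎)
  where open ℚ.≤-Reasoning

LnBound-intro : ∀ {a b K} → 1 ≤ b → 1 ≤ K → fromℕ a ≤ᵘ fromℕ b *ᵘ (1ℚᵘ +ᵘ harmonicTail (K ∸ 1)) → LnBound a b K
LnBound-intro {a} {suc b} {suc k} _ _ a≤b[1+H] N =
  ℚ.≤-trans (expPartial-mono (ℚ.nonNegative⁻¹ x) x≤H N) (exp-harmonicTail k N)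
  where
  x = mkℚᵘ (ℤ.+ (a ∸ suc b)) b
  x≤H : x ≤ᵘ harmonicTail k
  x≤H = mkℚᵘ-≤ (fromℕ-∸-≤ (harmonicTail-nonNeg k) a≤b[1+H])

-- The greedy run

module _ {n : ℕ} (G : Graph n) (m₀ : ℕ) {S* : Subset n} (S*-FTTD : FTTD G (suc m₀) S*) where

  greedy-bound : ∀ {A S g} → Greedy G (suc m₀) A S → GainsBoundedBy G m₀ A (suc g) →
                 fromℕ ∣ S ∣ ≤ᵘ fromℕ ∣ A ∣ +ᵘ remainingBound (deficit G m₀ A) ∣ S* ∣ g
  greedy-bound {A} {g = g} (stop _) _ =
    p≤p+q′ (0≤+ (0≤* (0≤fromℕ (deficit G m₀ A)) (0≤1/[1+] g)) (0≤* (0≤fromℕ ∣ S* ∣) (harmonicTail-nonNeg g)))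
  greedy-bound {A} {S} {g} (step x positive x∉A x-max greedy) bounded
    with greedy-step-gain G m₀ positive x-max
  ... | g′ , F[A∪x]≡ , bounded-by-x = begin
    fromℕ ∣ S ∣
      ≤⟨ greedy-bound greedy (gainsBoundedBy-⊆ G m₀ (p⊆p∪q ⁅ x ⁆) bounded-by-x) ⟩
    fromℕ ∣ A ∪ ⁅ x ⁆ ∣ +ᵘ remainingBound (deficit G m₀ (A ∪ ⁅ x ⁆)) b g′
      ≡⟨ cong (λ k → fromℕ k +ᵘ remainingBound (deficit G m₀ (A ∪ ⁅ x ⁆)) b g′) (∣p∪⁅x⁆∣≡1+∣p∣ A x∉A) ⟩
    fromℕ (suc ∣ A ∣) +ᵘ remainingBound (deficit G m₀ (A ∪ ⁅ x ⁆)) b g′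
      ≃⟨ remainingBound-step ∣ A ∣ (deficit G m₀ (A ∪ ⁅ x ⁆)) b g′ ⟩
    fromℕ ∣ A ∣ +ᵘ remainingBound (deficit G m₀ (A ∪ ⁅ x ⁆) + suc g′) b g′
      ≡⟨ cong (λ r → fromℕ ∣ A ∣ +ᵘ remainingBound r b g′) (deficit-∪⁅⁆ G m₀ {A} {x} F[A∪x]≡) ⟨
    fromℕ ∣ A ∣ +ᵘ remainingBound (deficit G m₀ A) b g′
      ≤⟨ ℚ.+-monoʳ-≤ (fromℕ ∣ A ∣) (remainingBound-mono (deficit-≤ G m₀ {A} S*-FTTD bounded-by-x) (≤⇒≤′ g′≤g)) ⟩
    fromℕ ∣ A ∣ +ᵘ remainingBound (deficit G m₀ A) b g
      ∎
    where
    open ℚ.≤-Reasoning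
    b = ∣ S* ∣
    g′≤g : g′ ≤ g
    g′≤g = ≤-pred (+-cancelˡ-≤ (F G m₀ A) _ _ (subst (_≤ F G m₀ A + suc g) F[A∪x]≡ (bounded x x∉A)))

  greedy-approximation : ∀ {S K} → Greedy G (suc m₀) ∅ S → GainsBoundedBy G m₀ ∅ K → 1 ≤ K →
                         fromℕ ∣ S ∣ ≤ᵘ fromℕ ∣ S* ∣ *ᵘ (1ℚᵘ +ᵘ harmonicTail (K ∸ 1))
  greedy-approximation {S} {suc k} greedy bounded _ = begin
    fromℕ ∣ S ∣
      ≤⟨ greedy-bound greedy bounded ⟩
    fromℕ ∣ ∅ {n} ∣ +ᵘ (fromℕ r *ᵘ 1/[1+ k ] +ᵘ fromℕ b *ᵘ H)
      ≡⟨ cong (λ a → fromℕ a +ᵘ (fromℕ r *ᵘ 1/[1+ k ] +ᵘ fromℕ b *ᵘ H)) (∣⊥∣≡0 n) ⟩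
    0ℚᵘ +ᵘ (fromℕ r *ᵘ 1/[1+ k ] +ᵘ fromℕ b *ᵘ H)
      ≤⟨ ℚ.+-monoʳ-≤ 0ℚᵘ (ℚ.+-monoˡ-≤ (fromℕ b *ᵘ H) r/[1+k]≤b) ⟩
    0ℚᵘ +ᵘ (fromℕ b +ᵘ fromℕ b *ᵘ H)
      ≃⟨ solve 2 (λ b h → con 0ℚᵘ :+ (b :+ b :* h) := b :* (con 1ℚᵘ :+ h)) ℚ.≃-refl (fromℕ b) H ⟩
    fromℕ b *ᵘ (1ℚᵘ +ᵘ H)
      ∎
    where
    open ℚ.≤-Reasoning
    b = ∣ S* ∣
    r = deficit G m₀ ∅
    H = harmonicTail k
    r*1≤b[1+k] : r * 1 ≤ b * suc k
    r*1≤b[1+k] = subst (_≤ b * suc k) (sym (*-identityʳ r)) (deficit-≤ G m₀ {∅} S*-FTTD bounded)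
    r/[1+k]≤b : fromℕ r *ᵘ 1/[1+ k ] ≤ᵘ fromℕ b
    r/[1+k]≤b = ℚ.≤-trans (fromℕ*1/[1+]-≤ {r} {b} {k} {0} r*1≤b[1+k]) (ℚ.≤-reflexive (ℚ.*-identityʳ (fromℕ b)))

theorem5 : ∀ {n} (G : Graph n) → 1 ≤ n → NoIsolated G → (m : ℕ) → 1 ≤ m →
    (S : Subset n) → Greedy G m ∅ S →
    (Sstar : Subset n) → MinFTTD G m Sstar →
    FTTD G m S × LnBound ∣ S ∣ ∣ Sstar ∣ (maxDeg G + m ∸ 1)
theorem5 G 1≤n noIsolated (suc m₀) 1≤m S greedy S* (S*-FTTD , _) = S-FTTD , S-small
  where
  S-FTTD : FTTD G (suc m₀) S
  S-FTTD = stuck⇒FTTD G m₀ noIsolated λ u u∉S → gain-≤0⇒ G m₀ {S} {u} (Greedy-stuck G greedy u u∉S)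

  1≤K : 1 ≤ maxDeg G + m₀
  1≤K = ≤-trans (1≤maxDeg G 1≤n noIsolated) (m≤m+n (maxDeg G) m₀)

  S-small : LnBound ∣ S ∣ ∣ S* ∣ (maxDeg G + suc m₀ ∸ 1)
  S-small = subst (LnBound ∣ S ∣ ∣ S* ∣) (cong (_∸ 1) (sym (+-suc (maxDeg G) m₀)))
    (LnBound-intro (FTTD-nonempty G 1≤n 1≤m S*-FTTD) 1≤K
      (greedy-approximation G m₀ S*-FTTD greedy (gains-from-∅ G m₀) 1≤K))
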